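{- Let $u$ and $v$ be two true twins in a graph $G=(V,E)$ that are not universal. Then in any generalized $2$-community structure of $G$, $u$ and $v$ belong to the same community.
   Context: $u,v$ are true twins if $N[u]=N[v]$ (closed neighbourhoods). A vertex is universal if its closed neighbourhood is $V$. $N_C(v)$ is the set of neighbours of $v$ in $C$. A generalized $2$-community structure of $G$ is a partition of $V$ into two nonempty sets $C_1,C_2$ (the communities) such that for $i\in\{1,2\}$ and every $w\in C_i$: $|N_{C_i}(w)|\cdot|C_{3-i}|\ge |N_{C_{3-i}}(w)|\cdot(|C_i|-1)$. -}

module Defs where

open import Data.Nat using (ℕ; zero; suc; _+_; _*_; _∸_; _≥_)
open import Data.Bool using (Bool; true; false; _∧_; _∨_; not; if_then_else_)
open import Data.Fin using (Fin) renaming (zero to fzero; suc to fsuc)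
open import Data.Fin.Properties using (_≟_)
import Data.Bool.Properties as BoolP
open import Data.Product using (Σ; ∃; _×_; _,_)
open import Data.Empty using (⊥)
open import Relation.Nullary using (¬_)
open import Relation.Nullary.Decidable using (⌊_⌋)
open import Relation.Binary.PropositionalEquality using (_≡_)

record Graph (n : ℕ) : Set where
  field
    adj    : Fin n → Fin n → Bool
    sym    : ∀ u v → adj u v ≡ adj v u
    irrefl : ∀ u → adj u u ≡ false
open Graph public

count : {n : ℕ} → (Fin n → Bool) → ℕ
count {zero}  p = 0
count {suc n} p = (if p fzero then 1 else 0) + count (λ i → p (fsuc i))

closedNbr : {n : ℕ} → Graph n → Fin n → Fin n → Bool
closedNbr G u w = ⌊ u ≟ w ⌋ ∨ adj G u w

TrueTwins : {n : ℕ} → Graph n → Fin n → Fin n → Set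
TrueTwins G u v = ∀ w → closedNbr G u w ≡ closedNbr G v w

Universal : {n : ℕ} → Graph n → Fin n → Set
Universal G u = ∀ w → closedNbr G u w ≡ true

-- A bipartition of V into two sets is encoded by a colouring
-- side : Fin n → Bool; C_b = { w | side w ≡ b }.
-- size of the community with label b
commSize : {n : ℕ} → (Fin n → Bool) → Bool → ℕ
commSize side b = count (λ w → ⌊ BoolP._≟_ (side w) b ⌋)

nbrsIn : {n : ℕ} → Graph n → (Fin n → Bool) → Fin n → Bool → ℕ
nbrsIn G side w b = count (λ x → adj G w x ∧ ⌊ BoolP._≟_ (side x) b ⌋)

IsGen2CommunityStructure : {n : ℕ} → Graph n → (Fin n → Bool) → Set
IsGen2CommunityStructure G side =
  (∃ λ x → side x ≡ true) × (∃ λ y → side y ≡ false) ×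
  (∀ w → nbrsIn G side w (side w) * commSize side (not (side w))
          ≥ nbrsIn G side w (not (side w)) * (commSize side (side w) ∸ 1))

-- If the twins u, v sit in different communities C and D, each of them has in
-- the other's community exactly one neighbour more than its twin (the twin
-- itself).  Adding the two community inequalities then forces
-- |N_C(u)| = |C| - 1 and |N_D(v)| = |D| - 1, so N[u] ⊇ C and N[v] ⊇ D; as
-- N[u] = N[v], u is universal.
module Submission where

open import Defs hiding (sym)
open import Data.Nat using (ℕ; zero; suc; _+_; _*_; _∸_; _≤_; _<_; z≤n; s≤s; s≤s⁻¹)
open import Data.Nat.Properties
  using (≤-trans; m≤n⇒m≤1+n; <⇒≱; +-mono-≤; +-monoʳ-≤; +-monoˡ-≤; +-cancelˡ-≤; +-cancelʳ-≤)
open import Data.Nat.Solver using (module +-*-Solver)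
open import Data.Bool using (Bool; true; false; _∧_; not)
open import Data.Bool.Properties using (¬-not; ∧-zeroʳ; ∧-conicalˡ; ∧-conicalʳ) renaming (_≟_ to _≟ᵇ_)
open import Data.Fin using (Fin) renaming (zero to fzero; suc to fsuc)
open import Data.Fin.Properties using (_≟_; suc-injective)
open import Function using (_∘_)
open import Data.Product using (_×_; _,_; proj₁; proj₂)
open import Relation.Nullary using (¬_; yes; no; contradiction)
open import Relation.Nullary.Decidable using (Dec; ⌊_⌋; isYes≗does; dec-true; dec-false)
open import Relation.Binary.PropositionalEquality
  using (_≡_; _≢_; refl; sym; trans; cong; subst; subst₂; module ≡-Reasoning)

⌊⌋-true : {A : Set} (a? : Dec A) → A → ⌊ a? ⌋ ≡ true
⌊⌋-true a? a = trans (isYes≗does a?) (dec-true a? a)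

⌊⌋-false : {A : Set} (a? : Dec A) → ¬ A → ⌊ a? ⌋ ≡ false
⌊⌋-false a? ¬a = trans (isYes≗does a?) (dec-false a? ¬a)

_⊆_ : ∀ {n} → (Fin n → Bool) → (Fin n → Bool) → Set
p ⊆ q = ∀ x → p x ≡ true → q x ≡ true

count-cong : ∀ {n} {p q : Fin n → Bool} → (∀ x → p x ≡ q x) → count p ≡ count q
count-cong {zero}  p≗q = refl
count-cong {suc n} p≗q
  rewrite p≗q fzero = cong (_ +_) (count-cong (λ x → p≗q (fsuc x)))

count-mono : ∀ {n} {p q : Fin n → Bool} → p ⊆ q → count p ≤ count q
count-mono {zero}          p⊆q = z≤n
count-mono {suc n} {p} {q} p⊆q with p fzero in p0 | q fzero in q0
... | true  | true  = s≤s (count-mono (λ x → p⊆q (fsuc x)))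
... | true  | false = contradiction (trans (sym (p⊆q fzero p0)) q0) λ ()
... | false | true  = m≤n⇒m≤1+n (count-mono (λ x → p⊆q (fsuc x)))
... | false | false = count-mono (λ x → p⊆q (fsuc x))

count-insert : ∀ {n} {p q : Fin n → Bool} (w : Fin n) → p w ≡ false → q w ≡ true →
  (∀ x → x ≢ w → p x ≡ q x) → count q ≡ suc (count p)
count-insert {suc n} fzero pw qw agree rewrite pw | qw =
  cong suc (count-cong (λ x → sym (agree (fsuc x) λ ())))
count-insert {suc n} {q = q} (fsuc w) pw qw agree
  rewrite agree fzero (λ ()) with q fzero
... | true  = cong suc (count-insert w pw qw (λ x x≢w → agree (fsuc x) (x≢w ∘ suc-injective)))
... | false = count-insert w pw qw (λ x x≢w → agree (fsuc x) (x≢w ∘ suc-injective))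

count-saturated : ∀ {n} {p q : Fin n → Bool} → p ⊆ q → count q ≤ count p → q ⊆ p
count-saturated {suc n} {p} {q} p⊆q q≤p x qx with p fzero in p0 | q fzero in q0
... | true  | false = contradiction (trans (sym (p⊆q fzero p0)) q0) λ ()
... | false | true  = contradiction q≤p (<⇒≱ (s≤s (count-mono (λ y → p⊆q (fsuc y)))))
count-saturated {suc n} p⊆q q≤p fzero    qx | true  | true  = p0
count-saturated {suc n} p⊆q q≤p (fsuc x) qx | true  | true  =
  count-saturated (λ y → p⊆q (fsuc y)) (s≤s⁻¹ q≤p) x qx
count-saturated {suc n} p⊆q q≤p fzero    qx | false | false = contradiction (trans (sym qx) q0) λ ()
count-saturated {suc n} p⊆q q≤p (fsuc x) qx | false | false =
  count-saturated (λ y → p⊆q (fsuc y)) q≤p x qx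

-- s, t play the degrees |N_C(u)|, |N_D(v)| and a, b the sizes |C|, |D|.
community-inequalities-saturate : ∀ s t a b → s < a → t < b →
  suc t * (a ∸ 1) ≤ s * b → suc s * (b ∸ 1) ≤ t * a → a ≤ suc s × b ≤ suc t
community-inequalities-saturate s t (suc p) (suc q) s<a t<b ineq₁ ineq₂ =
    s≤s (+-cancelʳ-≤ q p s (≤-trans p+q≤s+t (+-monoʳ-≤ s (s≤s⁻¹ t<b))))
  , s≤s (+-cancelˡ-≤ p q t (≤-trans p+q≤s+t (+-monoˡ-≤ t (s≤s⁻¹ s<a))))
  where
    open +-*-Solver
    common = t * p + s * q
    lhs : suc t * p + suc s * q ≡ common + (p + q)
    lhs = solve 4 (λ s t p q → (con 1 :+ t) :* p :+ (con 1 :+ s) :* q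
                  := (t :* p :+ s :* q) :+ (p :+ q)) refl s t p q
    rhs : s * suc q + t * suc p ≡ common + (s + t)
    rhs = solve 4 (λ s t p q → s :* (con 1 :+ q) :+ t :* (con 1 :+ p)
                  := (t :* p :+ s :* q) :+ (s :+ t)) refl s t p q
    p+q≤s+t : p + q ≤ s + t
    p+q≤s+t = +-cancelˡ-≤ common _ _ (subst₂ _≤_ lhs rhs (+-mono-≤ ineq₁ ineq₂))

opposite : ∀ {b c : Bool} → b ≢ c → not b ≡ c
opposite sides-differ = sym (¬-not (sides-differ ∘ sym))

community : ∀ {n} → (Fin n → Bool) → Bool → Fin n → Bool
community side b x = ⌊ side x ≟ᵇ b ⌋

module _ {n : ℕ} (G : Graph n) where

  degreeIn : Fin n → (Fin n → Bool) → ℕ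
  degreeIn u C = count (λ x → adj G u x ∧ C x)

  closedDegreeIn : Fin n → (Fin n → Bool) → ℕ
  closedDegreeIn u C = count (λ x → closedNbr G u x ∧ C x)

  closedDegreeIn-count : ∀ u (C : Fin n → Bool) → C u ≡ true →
    closedDegreeIn u C ≡ suc (degreeIn u C)
  closedDegreeIn-count u C Cu = count-insert u adj-u-u closed-u-u agree
    where
      adj-u-u : adj G u u ∧ C u ≡ false
      adj-u-u rewrite irrefl G u = refl
      closed-u-u : closedNbr G u u ∧ C u ≡ true
      closed-u-u rewrite ⌊⌋-true (u ≟ u) refl | Cu = refl
      agree : ∀ x → x ≢ u → adj G u x ∧ C x ≡ closedNbr G u x ∧ C x
      agree x x≢u rewrite ⌊⌋-false (u ≟ x) (x≢u ∘ sym) = refl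

  degreeIn≡closedDegreeIn : ∀ v (C : Fin n → Bool) → C v ≡ false → degreeIn v C ≡ closedDegreeIn v C
  degreeIn≡closedDegreeIn v C Cv = count-cong pointwise
    where
      pointwise : ∀ x → adj G v x ∧ C x ≡ closedNbr G v x ∧ C x
      pointwise x with v ≟ x
      ... | yes refl rewrite Cv = ∧-zeroʳ (adj G v v)
      ... | no _     = refl

  twin-degreeIn : ∀ {u v} (C : Fin n → Bool) → TrueTwins G u v → C u ≡ true → C v ≡ false →
    degreeIn v C ≡ suc (degreeIn u C)
  twin-degreeIn {u} {v} C twins Cu Cv = begin
    degreeIn v C        ≡⟨ degreeIn≡closedDegreeIn v C Cv ⟩
    closedDegreeIn v C  ≡⟨ count-cong (λ x → cong (_∧ C x) (sym (twins x))) ⟩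
    closedDegreeIn u C  ≡⟨ closedDegreeIn-count u C Cu ⟩
    suc (degreeIn u C)  ∎
    where open ≡-Reasoning

  closedNbrsIn⊆ : ∀ u (C : Fin n → Bool) → (λ x → closedNbr G u x ∧ C x) ⊆ C
  closedNbrsIn⊆ u C x = ∧-conicalʳ _ _

  degreeIn<community : ∀ u (C : Fin n → Bool) → C u ≡ true → degreeIn u C < count C
  degreeIn<community u C Cu =
    subst (_≤ count C) (closedDegreeIn-count u C Cu) (count-mono (closedNbrsIn⊆ u C))

  community⊆closedNbr : ∀ u (C : Fin n → Bool) → C u ≡ true →
    count C ≤ suc (degreeIn u C) → C ⊆ closedNbr G u
  community⊆closedNbr u C Cu full x Cx = ∧-conicalˡ _ _
    (count-saturated (closedNbrsIn⊆ u C)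
      (subst (count C ≤_) (sym (closedDegreeIn-count u C Cu)) full) x Cx)

  balance-at : ∀ {side} → IsGen2CommunityStructure G side → ∀ w {c} → not (side w) ≡ c →
    nbrsIn G side w c * (commSize side (side w) ∸ 1) ≤ nbrsIn G side w (side w) * commSize side c
  balance-at (_ , _ , balanced) w refl = balanced w

  split-twin-universal : ∀ {u v side} → TrueTwins G u v → IsGen2CommunityStructure G side →
    side u ≢ side v → Universal G u
  split-twin-universal {u} {v} {side} twins structure sides-differ = universal
    where
    C = community side (side u)
    D = community side (side v)
    Cu : C u ≡ true
    Cu = ⌊⌋-true _ refl
    Dv : D v ≡ true
    Dv = ⌊⌋-true _ refl
    ineq-u : suc (degreeIn v D) * (count C ∸ 1) ≤ degreeIn u C * count D
    ineq-u = subst (λ k → k * (count C ∸ 1) ≤ degreeIn u C * count D)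
      (twin-degreeIn D (sym ∘ twins) Dv (⌊⌋-false _ sides-differ)) (balance-at structure u (opposite sides-differ))
    ineq-v : suc (degreeIn u C) * (count D ∸ 1) ≤ degreeIn v D * count C
    ineq-v = subst (λ k → k * (count D ∸ 1) ≤ degreeIn v D * count C)
      (twin-degreeIn C twins Cu (⌊⌋-false _ (sides-differ ∘ sym))) (balance-at structure v (opposite (sides-differ ∘ sym)))
    saturated : count C ≤ suc (degreeIn u C) × count D ≤ suc (degreeIn v D)
    saturated = community-inequalities-saturate _ _ _ _
      (degreeIn<community u C Cu) (degreeIn<community v D Dv) ineq-u ineq-v
    C⊆N[u] : C ⊆ closedNbr G u
    C⊆N[u] = community⊆closedNbr u C Cu (proj₁ saturated)
    D⊆N[v] : D ⊆ closedNbr G v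
    D⊆N[v] = community⊆closedNbr v D Dv (proj₂ saturated)
    universal : Universal G u
    universal w with side w ≟ᵇ side u
    ... | yes w∈C = C⊆N[u] w (⌊⌋-true _ w∈C)
    ... | no  w∉C = trans (twins w) (D⊆N[v] w (⌊⌋-true _ (trans (¬-not w∉C) (opposite sides-differ))))

-- Non-universality of v is implied by that of u, since N[u] = N[v].
mainTheorem11 : {n : ℕ} (G : Graph n) (u v : Fin n) →
    TrueTwins G u v → ¬ Universal G u → ¬ Universal G v →
    (side : Fin n → Bool) → IsGen2CommunityStructure G side →
    side u ≡ side v
mainTheorem11 G u v twins ¬universal-u _ side structure with side u ≟ᵇ side v
... | yes same   = same
... | no  differ = contradiction (split-twin-universal G twins structure differ) ¬universal-u
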